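{- Every $n$-step staircase $\mathcal{C}\subseteq\mathbb{Z}^3$ is closed under intersection: if $A,B\in\mathcal{C}$ then $A\cap B=(\min(x_A,x_B),\min(y_A,y_B),\min(z_A,z_B))\in\mathcal{C}$.
   Context: A digital cuboid is a set $C=\{(x,y,z)\in\mathbb{Z}^3: x_{\min}\le x\le x_{\max},\ y_{\min}\le y\le y_{\max},\ z_{\min}\le z\le z_{\max}\}$ with $|C|>1$. A sequence of cuboids $C_1,\dots,C_n$ (with $C_i$ having parameters $x^i_{\min},x^i_{\max}$, etc.) is regular if (a) $x^1_{\min}=y^1_{\min}=z^1_{\min}=0$; (b) for each $1\le i\le n-1$: $x^i_{\min}\le x^{i+1}_{\min}$, $y^i_{\min}\le y^{i+1}_{\min}$, $z^i_{\min}\le z^{i+1}_{\min}$, with at least one strict inequality; (c) for each $1\le i\le n-1$: $x^{i+1}_{\min}\le x^i_{\max}$, $y^{i+1}_{\min}\le y^i_{\max}$, $z^{i+1}_{\min}\le z^i_{\max}$; (d) for each $1\le i\le n-1$: $x^i_{\max}\le x^{i+1}_{\max}$, $y^i_{\max}\le y^{i+1}_{\max}$, $z^i_{\max}\le z^{i+1}_{\max}$, with at least one strict inequality. The union $\mathcal{C}=C_1\cup\dots\cup C_n$ of a regular sequence is an $n$-step staircase. -}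

module Defs where

open import Data.Nat using (ℕ; zero; suc)
open import Data.Integer using (ℤ; _≤_; _<_; _⊓_; +_)
open import Data.Fin using (Fin; inject₁; fromℕ)
open import Data.Product using (_×_; Σ; ∃; ∃-syntax; _,_)
open import Data.Sum using (_⊎_)
open import Relation.Binary.PropositionalEquality using (_≡_)

Point : Set
Point = ℤ × ℤ × ℤ

record Cuboid : Set where
  constructor cuboid
  field
    xmin xmax ymin ymax zmin zmax : ℤ

open Cuboid public

_∈C_ : Point → Cuboid → Set
(x , y , z) ∈C C =
  (xmin C ≤ x × x ≤ xmax C) × (ymin C ≤ y × y ≤ ymax C) × (zmin C ≤ z × z ≤ zmax C)

-- |C| > 1 : the cuboid contains two distinct points, i.e. it is nonempty
-- in each coordinate and strictly extended in at least one direction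
IsDigitalCuboid : Cuboid → Set
IsDigitalCuboid C =
  (xmin C ≤ xmax C × ymin C ≤ ymax C × zmin C ≤ zmax C)
  × (xmin C < xmax C ⊎ ymin C < ymax C ⊎ zmin C < zmax C)

ConsecutiveOK : Cuboid → Cuboid → Set
ConsecutiveOK C D =
  ((xmin C ≤ xmin D × ymin C ≤ ymin D × zmin C ≤ zmin D)
   × (xmin C < xmin D ⊎ ymin C < ymin D ⊎ zmin C < zmin D))
  × (xmin D ≤ xmax C × ymin D ≤ ymax C × zmin D ≤ zmax C)
  × ((xmax C ≤ xmax D × ymax C ≤ ymax D × zmax C ≤ zmax D)
     × (xmax C < xmax D ⊎ ymax C < ymax D ⊎ zmax C < zmax D))

-- a sequence C_1,…,C_n of length n = suc m (indices 0 … m)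
-- is regular: every member is a digital cuboid, (a), and (b)-(d)
Regular : (m : ℕ) → (Fin (suc m) → Cuboid) → Set
Regular m C =
  ((i : Fin (suc m)) → IsDigitalCuboid (C i))
  × (xmin (C Fin.zero) ≡ + 0 × ymin (C Fin.zero) ≡ + 0 × zmin (C Fin.zero) ≡ + 0)
  × ((i : Fin m) → ConsecutiveOK (C (inject₁ i)) (C (Fin.suc i)))

_∈Stair_ : Point → {m : ℕ} → (Fin (suc m) → Cuboid) → Set
p ∈Stair C = ∃[ i ] (p ∈C C i)

_⊓P_ : Point → Point → Point
(x₁ , y₁ , z₁) ⊓P (x₂ , y₂ , z₂) = (x₁ ⊓ x₂ , y₁ ⊓ y₂ , z₁ ⊓ z₂)

-- Along a regular sequence the lower corners (xmin, ymin, zmin) increase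
-- coordinatewise.  If A ∈ C_i and B ∈ C_j with i ≤ j, then A ⊓ B is bounded
-- above by A, hence by the upper corner of C_i, and below by the lower corner
-- of C_i, which lies below both A and the lower corner of C_j ≤ B.  So
-- A ⊓ B ∈ C_i.
module Submission where

open import Defs
open import Data.Nat using (ℕ; suc; z≤n; s≤s)
open import Data.Fin using (Fin; zero; suc; inject₁) renaming (_≤_ to _≤ᶠ_)
open import Data.Fin.Properties using () renaming (≤-total to ≤ᶠ-total)
open import Data.Integer using (_≤_; _⊓_)
open import Data.Integer.Properties using (≤-refl; ≤-trans; ⊓-glb; i≤j⇒i⊓k≤j; ⊓-comm)
open import Data.Product using (_×_; _,_; proj₁)
open import Data.Product.Relation.Binary.Pointwise.NonDependent using (Pointwise)
open import Data.Sum using (inj₁; inj₂)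
open import Level using (Level)
open import Relation.Binary.Core using (Rel)
open import Relation.Binary.Definitions using (Reflexive; Transitive)
open import Relation.Binary.PropositionalEquality using (_≡_; refl; subst)

module _ {a ℓ : Level} {A : Set a} {_≼_ : Rel A ℓ}
         (≼-refl : Reflexive _≼_) (≼-trans : Transitive _≼_) where

  stepwise⇒monotone : ∀ {m} (f : Fin (suc m) → A) →
    ((i : Fin m) → f (inject₁ i) ≼ f (suc i)) →
    ∀ {i j} → i ≤ᶠ j → f i ≼ f j
  stepwise⇒monotone f step {zero}  {zero}  _ = ≼-refl
  stepwise⇒monotone {suc m} f step {zero}  {suc j} _ =
    ≼-trans (step zero) (stepwise⇒monotone (λ k → f (suc k)) (λ k → step (suc k)) z≤n)
  stepwise⇒monotone {suc m} f step {suc i} {suc j} (s≤s i≤j) =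
    stepwise⇒monotone (λ k → f (suc k)) (λ k → step (suc k)) i≤j

_≤³_ : Rel Point _
_≤³_ = Pointwise _≤_ (Pointwise _≤_ _≤_)

≤³-refl : Reflexive _≤³_
≤³-refl = ≤-refl , ≤-refl , ≤-refl

≤³-trans : Transitive _≤³_
≤³-trans (x₁≤x₂ , y₁≤y₂ , z₁≤z₂) (x₂≤x₃ , y₂≤y₃ , z₂≤z₃) =
  ≤-trans x₁≤x₂ x₂≤x₃ , ≤-trans y₁≤y₂ y₂≤y₃ , ≤-trans z₁≤z₂ z₂≤z₃

lowerCorner : Cuboid → Point
lowerCorner C = xmin C , ymin C , zmin C

Regular⇒lowerCorner-monotone : ∀ {m} {C : Fin (suc m) → Cuboid} → Regular m C →
  ∀ {i j} → i ≤ᶠ j → lowerCorner (C i) ≤³ lowerCorner (C j)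
Regular⇒lowerCorner-monotone {C = C} (_ , _ , consecutive) =
  stepwise⇒monotone {_≼_ = _≤³_} ≤³-refl ≤³-trans (λ k → lowerCorner (C k))
    (λ k → proj₁ (proj₁ (consecutive k)))

⊓-∈-interval : ∀ {a b lo hi lo′} → lo ≤ a → a ≤ hi → lo ≤ lo′ → lo′ ≤ b →
  lo ≤ a ⊓ b × a ⊓ b ≤ hi
⊓-∈-interval {b = b} lo≤a a≤hi lo≤lo′ lo′≤b =
  ⊓-glb lo≤a (≤-trans lo≤lo′ lo′≤b) , i≤j⇒i⊓k≤j b a≤hi

⊓P-∈C-lower : ∀ {A B C D} → A ∈C C → B ∈C D → lowerCorner C ≤³ lowerCorner D →
  (A ⊓P B) ∈C C
⊓P-∈C-lower ((xA₁ , xA₂) , (yA₁ , yA₂) , (zA₁ , zA₂))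
            ((xB₁ , _)   , (yB₁ , _)   , (zB₁ , _))
            (xC≤xD , yC≤yD , zC≤zD) =
  ⊓-∈-interval xA₁ xA₂ xC≤xD xB₁ ,
  ⊓-∈-interval yA₁ yA₂ yC≤yD yB₁ ,
  ⊓-∈-interval zA₁ zA₂ zC≤zD zB₁

⊓P-comm : (A B : Point) → A ⊓P B ≡ B ⊓P A
⊓P-comm (xA , yA , zA) (xB , yB , zB)
  rewrite ⊓-comm xA xB | ⊓-comm yA yB | ⊓-comm zA zB = refl

mainTheorem9 : (m : ℕ) (C : Fin (suc m) → Cuboid) → Regular m C →
    (A B : Point) → A ∈Stair C → B ∈Stair C → (A ⊓P B) ∈Stair C
mainTheorem9 m C regular A B (i , A∈Cᵢ) (j , B∈Cⱼ) with ≤ᶠ-total i j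
... | inj₁ i≤j = i , ⊓P-∈C-lower A∈Cᵢ B∈Cⱼ (Regular⇒lowerCorner-monotone regular i≤j)
... | inj₂ j≤i = j , subst (_∈C C j) (⊓P-comm B A)
                     (⊓P-∈C-lower B∈Cⱼ A∈Cᵢ (Regular⇒lowerCorner-monotone regular j≤i))
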